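{- Let $n\geq 1$. Consider words over the alphabet $\{x,y\}$ (finite sequences of letters; positions matter) and the substitution rules $x\mapsto xy$, $y\mapsto y$ (the Stirling grammar). Call a sequence of positive integers $1=s_1,s_2,\ldots,s_{n+1}$ admissible if, setting $a_1=xy$ and, for $j=2,\ldots,n+1$, defining $a_j$ as the word obtained from $a_{j-1}$ by replacing its $s_j$-th letter by its image under the rules (so a letter $x$ becomes the two-letter word $xy$, a letter $y$ stays $y$), one has $1\leq s_j\leq |a_{j-1}|$ for all $j$ (where $|a|$ is the length of $a$). The word $a_{n+1}$ is said to be generated by $(G^n,xy)$ via this sequence, and the multiset of words generated by $(G^n,xy)$ contains one copy of $a_{n+1}$ for each admissible sequence. Then there is a bijection between the set of contractions of the word $(b^{\dagger}b)^{n+1}$ and the multiset of words generated by $(G^n,xy)$.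
   Context: Contractions of $(b^{\dagger}b)^{n+1}$ are described via linear representations: place vertices $1,2,\ldots,2n+2$ on a line; the odd vertices $2j-1$ are black (corresponding to the letters $b^{\dagger}$) and the even vertices $2j$ are white (corresponding to the letters $b$). A contraction is a set of edges, each edge joining a white vertex $i$ to a black vertex $j$ with $i<j$, such that every vertex lies on at most one edge (the empty set of edges is allowed). -}

module Defs where

open import Data.Bool using (Bool; true; false; _∧_; _∨_; not)
open import Data.Nat using (ℕ; zero; suc; _+_; _*_; _≤_; _≤ᵇ_; _<ᵇ_)
open import Data.Fin using (Fin; toℕ)
open import Data.List using (List; []; _∷_; _++_; length; allFin; map)
open import Data.Nat.ListAction using (sum)
open import Data.Bool.ListAction using (all)
open import Data.Vec using (Vec; lookup; head; tail; toList)
open import Data.Product using (Σ; _×_)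
open import Data.Unit using (⊤)
open import Relation.Binary.PropositionalEquality using (_≡_)

-- Odd vertices are black (b†), even vertices white (b).

evenᵇ : ℕ → Bool
evenᵇ zero = true
evenᵇ (suc k) = not (evenᵇ k)

vertex : ∀ {N} → Fin N → ℕ
vertex i = suc (toℕ i)

isWhite : ∀ {N} → Fin N → Bool
isWhite i = evenᵇ (vertex i)

isBlack : ∀ {N} → Fin N → Bool
isBlack i = not (evenᵇ (vertex i))

-- A set of edges on the vertices 1..N is given by its characteristic
-- matrix: E[i][j] = true iff the edge (i,j) belongs to the set, where an
-- edge is recorded with its white end i first and its black end j second.
EdgeSet : ℕ → Set
EdgeSet N = Vec (Vec Bool N) N

edge? : ∀ {N} → EdgeSet N → Fin N → Fin N → Bool
edge? E i j = lookup (lookup E i) j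

edgeOK : ∀ {N} → Fin N → Fin N → Bool
edgeOK i j = isWhite i ∧ (isBlack j ∧ (vertex i <ᵇ vertex j))

b2n : Bool → ℕ
b2n true = 1
b2n false = 0

degree : ∀ {N} → EdgeSet N → Fin N → ℕ
degree {N} E v = sum (map (λ j → b2n (edge? E v j) + b2n (edge? E j v)) (allFin N))

isContractionᵇ : ∀ {N} → EdgeSet N → Bool
isContractionᵇ {N} E =
  all (λ i → all (λ j → not (edge? E i j) ∨ edgeOK i j) (allFin N)) (allFin N)
  ∧ all (λ v → degree E v ≤ᵇ 1) (allFin N)

Contraction : ℕ → Set
Contraction m = Σ (EdgeSet (2 * m)) (λ E → isContractionᵇ E ≡ true)

data Letter : Set where
  x y : Letter

Word : Set
Word = List Letter

image : Letter → Word
image x = x ∷ y ∷ []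
image y = y ∷ []

-- replace the s-th letter (1-indexed) of a word by its image
-- (words are left unchanged if s is out of range; never used then)
replaceAt : ℕ → Word → Word
replaceAt zero w = w
replaceAt (suc s) [] = []
replaceAt (suc zero) (c ∷ w) = image c ++ w
replaceAt (suc (suc s)) (c ∷ w) = c ∷ replaceAt (suc s) w

ValidFrom : Word → List ℕ → Set
ValidFrom a [] = ⊤
ValidFrom a (s ∷ ss) = (1 ≤ s × s ≤ length a) × ValidFrom (replaceAt s a) ss

run : Word → List ℕ → Word
run a [] = a
run a (s ∷ ss) = run (replaceAt s a) ss

axiom : Word
axiom = x ∷ y ∷ []

Admissible : ℕ → Set
Admissible n = Σ (Vec ℕ (suc n)) (λ s → (head s ≡ 1) × ValidFrom axiom (toList (tail s)))

generated : ∀ {n} → Admissible n → Word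
generated (s Data.Product., _) = run axiom (toList (tail s))

-- the multiset of words generated by (G^n, xy): one copy of a_{n+1}
-- for each admissible sequence (copies are tagged by their sequence)
GeneratedMultiset : ℕ → Set
GeneratedMultiset n = Σ (Admissible n) (λ σ → Σ Word (λ w → w ≡ generated σ))

module Submission where

-- Contractions of (b†b)^(n+1) and the words generated by the Stirling
-- grammar x ↦ xy, y ↦ y are both described by one tree of choices.
--
-- Grammar side: every word produced from x y has the form x yᵏ, and
-- rewriting one of its k+1 letters gives x yᵏ⁺¹ (the x) or x yᵏ (a y).
-- So an admissible sequence is a sequence of choices r ∈ Fin (k+1) in which
-- k evolves by `step`; these are the `Choices k n` below.
--
-- Contraction side: on vertices 1,…,N+2 the black vertex 1 is never matched,
-- and the white vertex 2 is matched to at most one black vertex that the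
-- contraction on the remaining N vertices leaves free.  Hence a contraction
-- on N+2 vertices is a contraction c on N vertices together with one of
-- free(c)+1 choices, and the number of free black vertices evolves by the
-- same `step`.  Peeling vertices off two at a time therefore gives a
-- grade-preserving bijection between contractions on 2m vertices and
-- Choices 0 m, built with the choice made last.

open import Defs
open import Data.Nat using (ℕ; suc; _≤_)
open import Function.Bundles using (_⤖_)

open import Axiom.UniquenessOfIdentityProofs using (module Decidable⇒UIP)
open import Data.Bool as Bool using (Bool; true; false; T; _∧_; _∨_; not)
open import Data.Bool.Properties using (T-≡; T-∧; ∧-zeroʳ; ∧-identityʳ; not-involutive)
open import Data.Bool.ListAction using (all)
open import Data.Empty using (⊥; ⊥-elim)
open import Data.Fin using (Fin; zero; suc; toℕ; fromℕ<; punchIn)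
open import Data.Fin.Properties using (toℕ-fromℕ<; fromℕ<-toℕ; toℕ<n)
open import Data.List as List using ([]; _∷_; allFin)
open import Data.List.Properties using (length-replicate; map-tabulate; tabulate-cong)
open import Data.List.Relation.Unary.All.Properties using (all⁺; all⁻; tabulate⁺; tabulate⁻)
open import Data.Nat using (zero; _+_; _*_; _≤ᵇ_; _<ᵇ_; _≡ᵇ_; z≤n; s≤s; s≤s⁻¹)
open import Data.Nat.ListAction using (sum)
open import Data.Nat.Properties
  using (≤-irrelevant; ≤-trans; ≤-reflexive; m≤n+m; n≤0⇒n≡0; +-identityʳ; *-suc; ≤ᵇ⇒≤; ≤⇒≤ᵇ; ≡ᵇ⇒≡; ≡⇒≡ᵇ)
open import Data.Product using (Σ; _×_; _,_; proj₁; proj₂; uncurry)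
open import Data.Product.Function.Dependent.Propositional using (Σ-↔)
open import Data.Unit using (⊤; tt)
open import Data.Vec as Vec using (Vec; []; _∷_; lookup; toList)
open import Data.Vec.Properties as VecP
  using (lookup-map; lookup-replicate; lookup∘tabulate; tabulate∘lookup; lookup-zipWith; map-∘; map-id)
open import Function using (_∘_; id; _⇔_; mk⇔; Equivalence; _↔_; Inverse; mk↔ₛ′)
open import Function.Properties.Inverse using (↔-refl; ↔-trans; ↔⇒⤖)
open import Function.Related.Propositional using (module EquationalReasoning; bijection)
open import Relation.Binary.PropositionalEquality
  using (_≡_; refl; sym; trans; cong; cong₂; subst; module ≡-Reasoning)

-- Choice sequences and graded bijections.

-- The Stirling statistic: from x yᵏ, rewriting letter 0 (the x) gives
-- x yᵏ⁺¹, rewriting any other letter gives x yᵏ back.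
step : (k : ℕ) → Fin (suc k) → ℕ
step k zero    = suc k
step k (suc _) = k

Choices : ℕ → ℕ → Set
Choices k zero    = ⊤
Choices k (suc n) = Σ (Fin (suc k)) (λ r → Choices (step k r) n)

final : ∀ k n → Choices k n → ℕ
final k zero    _       = k
final k (suc n) (r , q) = final (step k r) n q

record Graded : Set₁ where
  constructor graded
  field
    Carrier : Set
    grade   : Carrier → ℕ
open Graded

infix 4 _≅_

record _≅_ (A B : Graded) : Set where
  field
    iso       : Carrier A ↔ Carrier B
    preserves : ∀ a → grade B (Inverse.to iso a) ≡ grade A a
open _≅_

≅-trans : ∀ {A B C} → A ≅ B → B ≅ C → A ≅ C
≅-trans f g = record
  { iso       = ↔-trans (iso f) (iso g)
  ; preserves = λ a → trans (preserves g _) (preserves f a)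
  }

extend : Graded → Graded
extend A = graded (Σ (Carrier A) (λ a → Fin (suc (grade A a))))
                  (λ (a , r) → step (grade A a) r)

fin-≡ : ∀ {k k′} → k ≡ k′ → Fin (suc k) ↔ Fin (suc k′)
fin-≡ refl = ↔-refl

step-fin-≡ : ∀ {k k′} (e : k ≡ k′) (r : Fin (suc k)) →
             step k′ (Inverse.to (fin-≡ e) r) ≡ step k r
step-fin-≡ refl r = refl

extend-cong : ∀ {A B} → A ≅ B → extend A ≅ extend B
extend-cong f = record
  { iso       = Σ-↔ (iso f) (λ {a} → fin-≡ (sym (preserves f a)))
  ; preserves = λ (a , r) → step-fin-≡ (sym (preserves f a)) r
  }

ChoicesG : ℕ → ℕ → Graded
ChoicesG k n = graded (Choices k n) (final k n)

snoc : ∀ k n (q : Choices k n) → Fin (suc (final k n q)) → Choices k (suc n)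
snoc k zero    tt       r = r , tt
snoc k (suc n) (r₀ , q) r = r₀ , snoc (step k r₀) n q r

unsnoc : ∀ k n → Choices k (suc n) → Σ (Choices k n) (λ q → Fin (suc (final k n q)))
unsnoc k zero    (r , tt)  = tt , r
unsnoc k (suc n) (r₀ , q′) = let (q , r) = unsnoc (step k r₀) n q′ in (r₀ , q) , r

snoc-unsnoc : ∀ k n q → uncurry (snoc k n) (unsnoc k n q) ≡ q
snoc-unsnoc k zero    (r , tt)  = refl
snoc-unsnoc k (suc n) (r₀ , q′) = cong (r₀ ,_) (snoc-unsnoc (step k r₀) n q′)

unsnoc-snoc : ∀ k n q r → unsnoc k n (snoc k n q r) ≡ (q , r)
unsnoc-snoc k zero    tt       r = refl
unsnoc-snoc k (suc n) (r₀ , q) r rewrite unsnoc-snoc (step k r₀) n q r = refl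

final-snoc : ∀ k n q r → final k (suc n) (snoc k n q r) ≡ step (final k n q) r
final-snoc k zero    tt       r = refl
final-snoc k (suc n) (r₀ , q) r = final-snoc (step k r₀) n q r

choices-snoc : ∀ k n → extend (ChoicesG k n) ≅ ChoicesG k (suc n)
choices-snoc k n = record
  { iso       = mk↔ₛ′ (uncurry (snoc k n)) (unsnoc k n) (snoc-unsnoc k n)
                      (λ (q , r) → unsnoc-snoc k n q r)
  ; preserves = λ (q , r) → final-snoc k n q r
  }

-- The grammar side: runs from x yᵏ are choice sequences.

xyᵏ : ℕ → Word
xyᵏ k = x ∷ List.replicate k y

length-xyᵏ : ∀ k → List.length (xyᵏ k) ≡ suc k
length-xyᵏ k = cong suc (length-replicate k)

replace-yᵏ : ∀ s k → replaceAt s (List.replicate k y) ≡ List.replicate k y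
replace-yᵏ zero          k       = refl
replace-yᵏ (suc s)       zero    = refl
replace-yᵏ (suc zero)    (suc k) = refl
replace-yᵏ (suc (suc s)) (suc k) = cong (y ∷_) (replace-yᵏ (suc s) k)

replace-xyᵏ : ∀ k (r : Fin (suc k)) → replaceAt (suc (toℕ r)) (xyᵏ k) ≡ xyᵏ (step k r)
replace-xyᵏ k zero    = refl
replace-xyᵏ k (suc r) = cong (x ∷_) (replace-yᵏ (suc (toℕ r)) k)

Runs : ℕ → ℕ → Set
Runs k n = Σ (Vec ℕ n) (λ ss → ValidFrom (xyᵏ k) (toList ss))

validFrom-irrelevant : ∀ w ss (p q : ValidFrom w ss) → p ≡ q
validFrom-irrelevant w []       tt tt = refl
validFrom-irrelevant w (s ∷ ss) ((p₁ , p₂) , p) ((q₁ , q₂) , q) =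
  cong₂ _,_ (cong₂ _,_ (≤-irrelevant p₁ q₁) (≤-irrelevant p₂ q₂))
            (validFrom-irrelevant _ ss p q)

runs-≡ : ∀ {k n} (ρ σ : Runs k n) → proj₁ ρ ≡ proj₁ σ → ρ ≡ σ
runs-≡ (ss , p) (.ss , q) refl = cong (ss ,_) (validFrom-irrelevant _ _ p q)

position : ∀ k s → 1 ≤ s → s ≤ List.length (xyᵏ k) → Fin (suc k)
position k zero    ()
position k (suc i) _  s≤len = fromℕ< (≤-trans s≤len (≤-reflexive (length-xyᵏ k)))

toℕ-position : ∀ k s (p : 1 ≤ s) (q : s ≤ List.length (xyᵏ k)) →
               suc (toℕ (position k s p q)) ≡ s
toℕ-position k (suc i) _ _ = cong suc (toℕ-fromℕ< _)

runs-first-step : ∀ k n → Runs k (suc n) ↔ Σ (Fin (suc k)) (λ r → Runs (step k r) n)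
runs-first-step k n = mk↔ₛ′ first unfirst first-unfirst unfirst-first
  where
  ValidAfter : Vec ℕ n → Word → Set
  ValidAfter ss w = ValidFrom w (toList ss)

  first : Runs k (suc n) → Σ (Fin (suc k)) (λ r → Runs (step k r) n)
  first (s ∷ ss , (p , q) , v) = r , ss , subst (ValidAfter ss) rewritten v
    where
    r : Fin (suc k)
    r = position k s p q
    rewritten : replaceAt s (xyᵏ k) ≡ xyᵏ (step k r)
    rewritten = trans (cong (λ s′ → replaceAt s′ (xyᵏ k)) (sym (toℕ-position k s p q)))
                      (replace-xyᵏ k r)

  unfirst : Σ (Fin (suc k)) (λ r → Runs (step k r) n) → Runs k (suc n)
  unfirst (r , ss , v) =
    suc (toℕ r) ∷ ss ,
    (s≤s z≤n , ≤-trans (toℕ<n r) (≤-reflexive (sym (length-xyᵏ k)))) ,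
    subst (ValidAfter ss) (sym (replace-xyᵏ k r)) v

  choice-≡ : ∀ {r r′} {ρ : Runs (step k r) n} {ρ′ : Runs (step k r′) n} →
             r′ ≡ r → proj₁ ρ′ ≡ proj₁ ρ →
             _≡_ {A = Σ (Fin (suc k)) (λ r → Runs (step k r) n)} (r′ , ρ′) (r , ρ)
  choice-≡ {r} {ρ = ρ} {ρ′} refl e = cong (r ,_) (runs-≡ ρ′ ρ e)

  first-unfirst : ∀ c → first (unfirst c) ≡ c
  first-unfirst (r , ρ) = choice-≡ (fromℕ<-toℕ r _) refl

  unfirst-first : ∀ ρ → unfirst (first ρ) ≡ ρ
  unfirst-first ρ@(s ∷ ss , (p , q) , v) = runs-≡ _ ρ (cong (_∷ ss) (toℕ-position k s p q))

runs↔choices : ∀ k n → Runs k n ↔ Choices k n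
runs↔choices k zero    = mk↔ₛ′ (λ _ → tt) (λ _ → [] , tt) (λ _ → refl) (λ { ([] , tt) → refl })
runs↔choices k (suc n) = ↔-trans (runs-first-step k n) (Σ-↔ ↔-refl (runs↔choices _ n))

admissible↔runs : ∀ n → Admissible n ↔ Runs 1 n
admissible↔runs n = mk↔ₛ′ (λ (s , _ , v) → Vec.tail s , v) (λ (ss , v) → 1 ∷ ss , refl , v)
                          (λ _ → refl) (λ { (1 ∷ ss , refl , v) → refl })

multiset↔admissible : ∀ n → GeneratedMultiset n ↔ Admissible n
multiset↔admissible n = mk↔ₛ′ proj₁ (λ σ → σ , generated σ , refl)
                              (λ _ → refl) (λ { (σ , _ , refl) → refl })

first-choice-forced : ∀ n → Choices 0 (suc n) ↔ Choices 1 n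
first-choice-forced n = mk↔ₛ′ (λ { (zero , q) → q }) (zero ,_) (λ _ → refl) (λ { (zero , q) → refl })

-- Selecting at most one marked position of a Boolean vector.

weight : ∀ {n} → Vec Bool n → ℕ
weight []      = 0
weight (b ∷ t) = b2n b + weight t

_∖_ : ∀ {n} → Vec Bool n → Vec Bool n → Vec Bool n
_∖_ = Vec.zipWith (λ p q → p ∧ not q)

Selection : ∀ {n} → Vec Bool n → Vec Bool n → Set
Selection a t = (∀ j → T (lookup t j) → T (lookup a j)) × weight t ≤ 1

-- Selections from a are coded by Fin (1 + weight a): zero is the empty
-- selection, suc i selects the i-th marked position.  When the first marked
-- position is skipped, `punchIn (suc zero)` leaves room for its code 1.
encode : ∀ {n} (a t : Vec Bool n) → Fin (suc (weight a))
encode []          []          = zero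
encode (true ∷ a)  (true ∷ t)  = suc zero
encode (true ∷ a)  (false ∷ t) = punchIn (suc zero) (encode a t)
encode (false ∷ a) (_ ∷ t)     = encode a t

decode : ∀ {n} (a : Vec Bool n) → Fin (suc (weight a)) → Vec Bool n
decode []          _             = []
decode (true ∷ a)  zero          = false ∷ decode a zero
decode (true ∷ a)  (suc zero)    = true ∷ Vec.replicate _ false
decode (true ∷ a)  (suc (suc r)) = false ∷ decode a (suc r)
decode (false ∷ a) r             = false ∷ decode a r

weight-replicate-false : ∀ n → weight (Vec.replicate n false) ≡ 0
weight-replicate-false zero    = refl
weight-replicate-false (suc n) = weight-replicate-false n

weight-zero : ∀ {n} (t : Vec Bool n) → weight t ≡ 0 → t ≡ Vec.replicate n false
weight-zero []          _ = refl
weight-zero (false ∷ t) e = cong (false ∷_) (weight-zero t e)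

decode-⊆ : ∀ {n} (a : Vec Bool n) r j → T (lookup (decode a r) j) → T (lookup a j)
decode-⊆ (true ∷ a)  zero          (suc j) e = decode-⊆ a zero j e
decode-⊆ (true ∷ a)  (suc zero)    zero    e = e
decode-⊆ (true ∷ a)  (suc zero)    (suc j) e = ⊥-elim (subst T (lookup-replicate j false) e)
decode-⊆ (true ∷ a)  (suc (suc r)) (suc j) e = decode-⊆ a (suc r) j e
decode-⊆ (false ∷ a) r             (suc j) e = decode-⊆ a r j e

decode-weight : ∀ {n} (a : Vec Bool n) r → weight (decode a r) ≤ 1
decode-weight []          zero          = z≤n
decode-weight (true ∷ a)  zero          = decode-weight a zero
decode-weight {suc n} (true ∷ a) (suc zero) = s≤s (≤-reflexive (weight-replicate-false n))
decode-weight (true ∷ a)  (suc (suc r)) = decode-weight a (suc r)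
decode-weight (false ∷ a) r             = decode-weight a r

decode-selection : ∀ {n} (a : Vec Bool n) r → Selection a (decode a r)
decode-selection a r = decode-⊆ a r , decode-weight a r

encode-decode : ∀ {n} (a : Vec Bool n) r → encode a (decode a r) ≡ r
encode-decode []          zero          = refl
encode-decode (true ∷ a)  zero          = cong (punchIn (suc zero)) (encode-decode a zero)
encode-decode (true ∷ a)  (suc zero)    = refl
encode-decode (true ∷ a)  (suc (suc r)) = cong (punchIn (suc zero)) (encode-decode a (suc r))
encode-decode (false ∷ a) r             = encode-decode a r

decode-encode : ∀ {n} (a t : Vec Bool n) → Selection a t → decode a (encode a t) ≡ t
decode-encode []          []          _              = refl
decode-encode (true ∷ a)  (true ∷ t)  (_ , s≤s w≤0)  = cong (true ∷_) (sym (weight-zero t (n≤0⇒n≡0 w≤0)))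
decode-encode (true ∷ a)  (false ∷ t) (⊆ , w≤1)      = skip (encode a t) (decode-encode a t (⊆ ∘ suc , w≤1))
  where
  skip : ∀ r → decode a r ≡ t → decode (true ∷ a) (punchIn (suc zero) r) ≡ false ∷ t
  skip zero    e = cong (false ∷_) e
  skip (suc r) e = cong (false ∷_) e
decode-encode (false ∷ a) (true ∷ t)  (⊆ , _)        = ⊥-elim (⊆ zero tt)
decode-encode (false ∷ a) (false ∷ t) (⊆ , w≤1)      = cong (false ∷_) (decode-encode a t (⊆ ∘ suc , w≤1))

weight-∖-nothing : ∀ {n} (a : Vec Bool n) → weight (a ∖ Vec.replicate n false) ≡ weight a
weight-∖-nothing []      = refl
weight-∖-nothing (p ∷ a) = cong₂ _+_ (cong b2n (∧-identityʳ p)) (weight-∖-nothing a)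

weight-∖-decode : ∀ {n} (a : Vec Bool n) r → suc (weight (a ∖ decode a r)) ≡ step (weight a) r
weight-∖-decode []          zero          = refl
weight-∖-decode (true ∷ a)  zero          = cong suc (weight-∖-decode a zero)
weight-∖-decode (true ∷ a)  (suc zero)    = cong suc (weight-∖-nothing a)
weight-∖-decode (true ∷ a)  (suc (suc r)) = cong suc (weight-∖-decode a (suc r))
weight-∖-decode (false ∷ a) r             = weight-∖-decode a r

ContractionOn : ℕ → Set
ContractionOn N = Σ (EdgeSet N) (λ E → isContractionᵇ E ≡ true)

bool-≡-irrelevant : ∀ {a b : Bool} (p q : a ≡ b) → p ≡ q
bool-≡-irrelevant = Decidable⇒UIP.≡-irrelevant Bool._≟_

contraction-≡ : ∀ {N} {c d : ContractionOn N} → proj₁ c ≡ proj₁ d → c ≡ d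
contraction-≡ {c = E , p} {.E , q} refl = cong (E ,_) (bool-≡-irrelevant p q)

IsContraction : ∀ {N} → EdgeSet N → Set
IsContraction E = (∀ i j → T (edge? E i j) → T (edgeOK i j)) × (∀ v → degree E v ≤ 1)

T-all-allFin : ∀ {N} (p : Fin N → Bool) → T (all p (allFin N)) ⇔ (∀ i → T (p i))
T-all-allFin {N} p = mk⇔ (tabulate⁻ ∘ all⁺ p (allFin N)) (all⁻ p ∘ tabulate⁺)

T-implies : ∀ {a b} → T (not a ∨ b) ⇔ (T a → T b)
T-implies {false} = mk⇔ (λ _ ()) (λ _ → tt)
T-implies {true}  = mk⇔ (λ t _ → t) (λ f → f tt)

isContractionᵇ-reflects : ∀ {N} (E : EdgeSet N) → isContractionᵇ E ≡ true ⇔ IsContraction E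
isContractionᵇ-reflects {N} E = mk⇔ sound complete
  where
  open Equivalence using (to; from)
  edgesᵇ degreesᵇ : Bool
  edgesᵇ   = all (λ i → all (λ j → not (edge? E i j) ∨ edgeOK i j) (allFin N)) (allFin N)
  degreesᵇ = all (λ v → degree E v ≤ᵇ 1) (allFin N)

  sound : isContractionᵇ E ≡ true → IsContraction E
  sound e = let (es , ds) = to (T-∧ {edgesᵇ} {degreesᵇ}) (from T-≡ e) in
    (λ i j → to T-implies (to (T-all-allFin _) (to (T-all-allFin _) es i) j)) ,
    (λ v → ≤ᵇ⇒≤ _ 1 (to (T-all-allFin _) ds v))

  complete : IsContraction E → isContractionᵇ E ≡ true
  complete (es , ds) = to T-≡ (from (T-∧ {edgesᵇ} {degreesᵇ})
    ( from (T-all-allFin _) (λ i → from (T-all-allFin _) (λ j → from T-implies (es i j)))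
    , from (T-all-allFin _) (λ v → ≤⇒≤ᵇ (ds v))))

holds : ∀ {N} (E : EdgeSet N) → isContractionᵇ E ≡ true → IsContraction E
holds E = Equivalence.to (isContractionᵇ-reflects E)

checks : ∀ {N} (E : EdgeSet N) → IsContraction E → isContractionᵇ E ≡ true
checks E = Equivalence.from (isContractionᵇ-reflects E)

vec-ext : ∀ {A : Set} {n} {u v : Vec A n} → (∀ i → lookup u i ≡ lookup v i) → u ≡ v
vec-ext {u = u} {v} h = trans (sym (tabulate∘lookup u)) (trans (VecP.tabulate-cong h) (tabulate∘lookup v))

edgeSet-ext : ∀ {N} {E F : EdgeSet N} → (∀ i j → edge? E i j ≡ edge? F i j) → E ≡ F
edgeSet-ext h = vec-ext (λ i → vec-ext (h i))

refute : ∀ {b} → (T b → ⊥) → b ≡ false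
refute {false} _ = refl
refute {true}  f = ⊥-elim (f tt)

isWhite-+2 : ∀ {N} (i : Fin N) → isWhite {suc (suc N)} (suc (suc i)) ≡ isWhite i
isWhite-+2 i = not-involutive _

isBlack-+2 : ∀ {N} (i : Fin N) → isBlack {suc (suc N)} (suc (suc i)) ≡ isBlack i
isBlack-+2 i = cong not (not-involutive _)

edgeOK-+2 : ∀ {N} (i j : Fin N) → edgeOK {suc (suc N)} (suc (suc i)) (suc (suc j)) ≡ edgeOK i j
edgeOK-+2 i j = cong₂ (λ w b → w ∧ (b ∧ (vertex i <ᵇ vertex j))) (isWhite-+2 i) (isBlack-+2 j)

edgeOK-from-2 : ∀ {N} (j : Fin N) → edgeOK {suc (suc N)} (suc zero) (suc (suc j)) ≡ isBlack j
edgeOK-from-2 j = trans (∧-identityʳ _) (isBlack-+2 j)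

-- No edge ends at vertex 1 (no earlier white vertex) or at vertex 2 (white).
edgeOK-to-1 : ∀ {N} (i : Fin (suc (suc N))) → edgeOK i zero ≡ false
edgeOK-to-1 i = ∧-zeroʳ (isWhite i)

edgeOK-to-2 : ∀ {N} (i : Fin (suc (suc N))) → edgeOK i (suc zero) ≡ false
edgeOK-to-2 i = ∧-zeroʳ (isWhite i)

incidence : ∀ {N} → EdgeSet N → Fin N → Fin N → ℕ
incidence E v j = b2n (edge? E v j) + b2n (edge? E j v)

degree-tabulate : ∀ {N} (E : EdgeSet N) v → degree E v ≡ sum (List.tabulate (incidence E v))
degree-tabulate E v = cong sum (map-tabulate id (incidence E v))

sum-zero : ∀ {n} (f : Fin n → ℕ) → (∀ j → f j ≡ 0) → sum (List.tabulate f) ≡ 0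
sum-zero {zero}  f h = refl
sum-zero {suc n} f h = cong₂ _+_ (h zero) (sum-zero (f ∘ suc) (h ∘ suc))

degree-isolated : ∀ {N} (E : EdgeSet N) v →
                  (∀ j → edge? E v j ≡ false) → (∀ j → edge? E j v ≡ false) → degree E v ≡ 0
degree-isolated E v out into =
  trans (degree-tabulate E v) (sum-zero _ (λ j → cong₂ (λ a b → b2n a + b2n b) (out j) (into j)))

sum-weight : ∀ {n} (t : Vec Bool n) → sum (List.tabulate (λ j → b2n (lookup t j))) ≡ weight t
sum-weight []      = refl
sum-weight (b ∷ t) = cong (b2n b +_) (sum-weight t)

-- Peeling off the first two vertices.

drop₂ : ∀ {A : Set} {n} → Vec A (suc (suc n)) → Vec A n
drop₂ (_ ∷ _ ∷ r) = r

pad₂ : ∀ {n} → Vec Bool n → Vec Bool (suc (suc n))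
pad₂ r = false ∷ false ∷ r

inner : ∀ {N} → EdgeSet (suc (suc N)) → EdgeSet N
inner (_ ∷ _ ∷ rows) = Vec.map drop₂ rows

toprow : ∀ {N} → EdgeSet (suc (suc N)) → Vec Bool N
toprow (_ ∷ r ∷ _) = drop₂ r

build : ∀ {N} → EdgeSet N → Vec Bool N → EdgeSet (suc (suc N))
build {N} c t = Vec.replicate (suc (suc N)) false ∷ pad₂ t ∷ Vec.map pad₂ c

lookup-drop₂ : ∀ {n} (r : Vec Bool (suc (suc n))) j → lookup (drop₂ r) j ≡ lookup r (suc (suc j))
lookup-drop₂ (_ ∷ _ ∷ _) j = refl

edge-inner : ∀ {N} (E : EdgeSet (suc (suc N))) i j →
             edge? (inner E) i j ≡ edge? E (suc (suc i)) (suc (suc j))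
edge-inner (_ ∷ _ ∷ rows) i j =
  trans (cong (λ r → lookup r j) (lookup-map i drop₂ rows)) (lookup-drop₂ (lookup rows i) j)

edge-toprow : ∀ {N} (E : EdgeSet (suc (suc N))) j → lookup (toprow E) j ≡ edge? E (suc zero) (suc (suc j))
edge-toprow (_ ∷ r ∷ _) j = lookup-drop₂ r j

edge-build : ∀ {N} (c : EdgeSet N) t i j →
             edge? (build c t) (suc (suc i)) j ≡ lookup (pad₂ (lookup c i)) j
edge-build c t i j = cong (λ r → lookup r j) (lookup-map i pad₂ c)

inner-build : ∀ {N} (c : EdgeSet N) t → inner (build c t) ≡ c
inner-build c t = trans (sym (map-∘ drop₂ pad₂ c)) (map-id c)

record Peelable {N} (E : EdgeSet (suc (suc N))) : Set where
  field
    row₁-empty : ∀ j → edge? E zero j ≡ false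
    col₁-empty : ∀ i → edge? E i zero ≡ false
    col₂-empty : ∀ i → edge? E i (suc zero) ≡ false

build-peelable : ∀ {N} (c : EdgeSet N) t → Peelable (build c t)
build-peelable c t = record { row₁-empty = λ j → lookup-replicate j false ; col₁-empty = col₁ ; col₂-empty = col₂ }
  where
  col₁ : ∀ i → edge? (build c t) i zero ≡ false
  col₁ zero          = refl
  col₁ (suc zero)    = refl
  col₁ (suc (suc i)) = edge-build c t i zero
  col₂ : ∀ i → edge? (build c t) i (suc zero) ≡ false
  col₂ zero          = refl
  col₂ (suc zero)    = refl
  col₂ (suc (suc i)) = edge-build c t i (suc zero)

-- Every contraction is peelable: vertex 1 is black with no earlier white
-- vertex, and vertex 2 is white.
contraction-peelable : ∀ {N} (E : EdgeSet (suc (suc N))) → IsContraction E → Peelable E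
contraction-peelable E (edges , _) = record
  { row₁-empty = λ j → refute (edges zero j)
  ; col₁-empty = λ i → refute (λ e → subst T (edgeOK-to-1 i) (edges i zero e))
  ; col₂-empty = λ i → refute (λ e → subst T (edgeOK-to-2 i) (edges i (suc zero) e))
  }

build-inner : ∀ {N} (E : EdgeSet (suc (suc N))) → Peelable E → build (inner E) (toprow E) ≡ E
build-inner E peelable = edgeSet-ext entry
  where
  open Peelable peelable
  open Peelable (build-peelable (inner E) (toprow E)) renaming
    (row₁-empty to b-row₁; col₁-empty to b-col₁; col₂-empty to b-col₂)
  entry : ∀ i j → edge? (build (inner E) (toprow E)) i j ≡ edge? E i j
  entry zero                j             = trans (b-row₁ j) (sym (row₁-empty j))
  entry i@(suc _)           zero          = trans (b-col₁ i) (sym (col₁-empty i))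
  entry i@(suc _)           (suc zero)    = trans (b-col₂ i) (sym (col₂-empty i))
  entry (suc zero)          (suc (suc j)) = edge-toprow E j
  entry (suc (suc i))       (suc (suc j)) = trans (edge-build (inner E) (toprow E) i (suc (suc j))) (edge-inner E i j)

degree-peel : ∀ {N} (E : EdgeSet (suc (suc N))) v →
  degree E (suc (suc v)) ≡
  incidence E (suc (suc v)) zero + (incidence E (suc (suc v)) (suc zero) + degree (inner E) v)
degree-peel E v = begin
    degree E (suc (suc v))
  ≡⟨ degree-tabulate E (suc (suc v)) ⟩
    via-1 + (via-2 + sum (List.tabulate (λ j → incidence E (suc (suc v)) (suc (suc j)))))
  ≡⟨ cong (λ d → via-1 + (via-2 + d)) (cong sum (tabulate-cong inner-incidence)) ⟩
    via-1 + (via-2 + sum (List.tabulate (incidence (inner E) v)))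
  ≡⟨ cong (λ d → via-1 + (via-2 + d)) (sym (degree-tabulate (inner E) v)) ⟩
    via-1 + (via-2 + degree (inner E) v)
  ∎
  where
  open ≡-Reasoning
  via-1 via-2 : ℕ
  via-1 = incidence E (suc (suc v)) zero
  via-2 = incidence E (suc (suc v)) (suc zero)
  inner-incidence : ∀ j → incidence E (suc (suc v)) (suc (suc j)) ≡ incidence (inner E) v j
  inner-incidence j = sym (cong₂ (λ a b → b2n a + b2n b) (edge-inner E v j) (edge-inner E j v))

module _ {N} (c : EdgeSet N) (t : Vec Bool N) where
  open Peelable (build-peelable c t)

  degree-build-1 : degree (build c t) zero ≡ 0
  degree-build-1 = degree-isolated (build c t) zero row₁-empty col₁-empty

  degree-build-2 : degree (build c t) (suc zero) ≡ weight t
  degree-build-2 = begin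
      degree (build c t) (suc zero)
    ≡⟨ degree-tabulate (build c t) (suc zero) ⟩
      sum (List.tabulate (λ j → b2n (lookup t j) + b2n (edge? (build c t) (suc (suc j)) (suc zero))))
    ≡⟨ cong sum (tabulate-cong (λ j → trans (cong (λ a → b2n (lookup t j) + b2n a) (col₂-empty (suc (suc j))))
                                             (+-identityʳ _))) ⟩
      sum (List.tabulate (λ j → b2n (lookup t j)))
    ≡⟨ sum-weight t ⟩
      weight t
    ∎
    where open ≡-Reasoning

  degree-build-+2 : ∀ v → degree (build c t) (suc (suc v)) ≡ b2n (lookup t v) + degree c v
  degree-build-+2 v = begin
      degree (build c t) (suc (suc v))
    ≡⟨ degree-peel (build c t) v ⟩
      incidence (build c t) (suc (suc v)) zero +
        (b2n (edge? (build c t) (suc (suc v)) (suc zero)) + b2n (lookup t v) + degree (inner (build c t)) v)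
    ≡⟨ no-edges-to-1-2 (col₁-empty (suc (suc v))) (row₁-empty (suc (suc v))) (col₂-empty (suc (suc v))) ⟩
      b2n (lookup t v) + degree (inner (build c t)) v
    ≡⟨ cong (λ E → b2n (lookup t v) + degree E v) (inner-build c t) ⟩
      b2n (lookup t v) + degree c v
    ∎
    where
    open ≡-Reasoning
    no-edges-to-1-2 : ∀ {a b d} → a ≡ false → b ≡ false → d ≡ false →
            b2n a + b2n b + (b2n d + b2n (lookup t v) + degree (inner (build c t)) v) ≡
            b2n (lookup t v) + degree (inner (build c t)) v
    no-edges-to-1-2 refl refl refl = refl

-- Free black vertices and the decomposition of contractions.

isFreeBlack : ∀ {N} → EdgeSet N → Fin N → Bool
isFreeBlack c j = isBlack j ∧ (degree c j ≡ᵇ 0)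

freeBlack : ∀ {N} → EdgeSet N → Vec Bool N
freeBlack c = Vec.tabulate (isFreeBlack c)

free : ∀ {N} → EdgeSet N → ℕ
free c = weight (freeBlack c)

T-freeBlack : ∀ {N} (c : EdgeSet N) j → T (lookup (freeBlack c) j) ⇔ (T (isBlack j) × degree c j ≡ 0)
T-freeBlack c j = mk⇔
  (λ e → let (b , z) = Equivalence.to T-∧ (subst T (lookup∘tabulate (isFreeBlack c) j) e) in b , ≡ᵇ⇒≡ _ 0 z)
  (λ (b , z) → subst T (sym (lookup∘tabulate (isFreeBlack c) j)) (Equivalence.from T-∧ (b , ≡⇒≡ᵇ _ 0 z)))

unbuild-contraction : ∀ {N} (c : EdgeSet N) t →
                      IsContraction (build c t) → IsContraction c × Selection (freeBlack c) t
unbuild-contraction c t (edges , degrees) = (inner-edges , inner-degrees) , (partner-free , weight-t)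
  where
  degree-+2 : ∀ v → b2n (lookup t v) + degree c v ≤ 1
  degree-+2 v = subst (_≤ 1) (degree-build-+2 c t v) (degrees (suc (suc v)))
  inner-edges : ∀ i j → T (edge? c i j) → T (edgeOK i j)
  inner-edges i j e =
    subst T (edgeOK-+2 i j) (edges (suc (suc i)) (suc (suc j)) (subst T (sym (edge-build c t i (suc (suc j)))) e))
  inner-degrees : ∀ v → degree c v ≤ 1
  inner-degrees v = ≤-trans (m≤n+m _ (b2n (lookup t v))) (degree-+2 v)
  partner-free : ∀ j → T (lookup t j) → T (lookup (freeBlack c) j)
  partner-free j e = Equivalence.from (T-freeBlack c j)
    ( subst T (edgeOK-from-2 j) (edges (suc zero) (suc (suc j)) e)
    , n≤0⇒n≡0 (s≤s⁻¹ (subst (λ b → b2n b + degree c j ≤ 1) (Equivalence.to T-≡ e) (degree-+2 j))))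
  weight-t : weight t ≤ 1
  weight-t = subst (_≤ 1) (degree-build-2 c t) (degrees (suc zero))

build-contraction : ∀ {N} (c : EdgeSet N) t →
                    IsContraction c × Selection (freeBlack c) t → IsContraction (build c t)
build-contraction c t ((edges , degrees) , (partner-free , weight-t)) = build-edges , build-degrees
  where
  open Peelable (build-peelable c t)
  build-edges : ∀ i j → T (edge? (build c t) i j) → T (edgeOK i j)
  build-edges zero            j             e = ⊥-elim (subst T (row₁-empty j) e)
  build-edges (suc zero)      zero          ()
  build-edges (suc zero)      (suc zero)    ()
  build-edges (suc zero)      (suc (suc j)) e =
    subst T (sym (edgeOK-from-2 j)) (proj₁ (Equivalence.to (T-freeBlack c j) (partner-free j e)))
  build-edges i@(suc (suc _)) zero          e = ⊥-elim (subst T (col₁-empty i) e)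
  build-edges i@(suc (suc _)) (suc zero)    e = ⊥-elim (subst T (col₂-empty i) e)
  build-edges (suc (suc i))   (suc (suc j)) e =
    subst T (sym (edgeOK-+2 i j)) (edges i j (subst T (edge-build c t i (suc (suc j))) e))
  partner-or-not : ∀ v b → lookup t v ≡ b → b2n b + degree c v ≤ 1
  partner-or-not v true  e = subst (λ d → 1 + d ≤ 1)
    (sym (proj₂ (Equivalence.to (T-freeBlack c v) (partner-free v (subst T (sym e) tt))))) (s≤s z≤n)
  partner-or-not v false _ = degrees v
  build-degrees : ∀ v → degree (build c t) v ≤ 1
  build-degrees zero          = subst (_≤ 1) (sym (degree-build-1 c t)) z≤n
  build-degrees (suc zero)    = subst (_≤ 1) (sym (degree-build-2 c t)) weight-t
  build-degrees (suc (suc v)) = subst (_≤ 1) (sym (degree-build-+2 c t v)) (partner-or-not v _ refl)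

-- Matching vertex 2 removes its partner from the free black vertices, and
-- vertex 1 is a new free black vertex.
free-build : ∀ {N} (c : EdgeSet N) t → free (build c t) ≡ suc (weight (freeBlack c ∖ t))
free-build c t = cong₂ (λ d w → b2n (d ≡ᵇ 0) + w) (degree-build-1 c t) (cong weight later)
  where
  open ≡-Reasoning
  removed : ∀ j b → isBlack j ∧ ((b2n b + degree c j) ≡ᵇ 0) ≡ isFreeBlack c j ∧ not b
  removed j true  = trans (∧-zeroʳ _) (sym (∧-zeroʳ _))
  removed j false = sym (∧-identityʳ _)
  later-entry : ∀ j → isFreeBlack (build c t) (suc (suc j)) ≡ lookup (freeBlack c ∖ t) j
  later-entry j = begin
      isBlack (suc (suc j)) ∧ (degree (build c t) (suc (suc j)) ≡ᵇ 0)
    ≡⟨ cong₂ (λ b d → b ∧ (d ≡ᵇ 0)) (isBlack-+2 j) (degree-build-+2 c t j) ⟩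
      isBlack j ∧ ((b2n (lookup t j) + degree c j) ≡ᵇ 0)
    ≡⟨ removed j (lookup t j) ⟩
      isFreeBlack c j ∧ not (lookup t j)
    ≡⟨ cong (_∧ not (lookup t j)) (sym (lookup∘tabulate (isFreeBlack c) j)) ⟩
      lookup (freeBlack c) j ∧ not (lookup t j)
    ≡⟨ sym (lookup-zipWith _ j (freeBlack c) t) ⟩
      lookup (freeBlack c ∖ t) j
    ∎
  later : Vec.tabulate (λ j → isFreeBlack (build c t) (suc (suc j))) ≡ freeBlack c ∖ t
  later = vec-ext (λ j → trans (lookup∘tabulate _ j) (later-entry j))

peel-contraction : ∀ {N} (E : EdgeSet (suc (suc N))) → IsContraction E →
                   IsContraction (inner E) × Selection (freeBlack (inner E)) (toprow E)
peel-contraction E h = unbuild-contraction (inner E) (toprow E)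
  (subst IsContraction (sym (build-inner E (contraction-peelable E h))) h)

free-peel : ∀ {N} (E : EdgeSet (suc (suc N))) → IsContraction E →
            step (free (inner E)) (encode (freeBlack (inner E)) (toprow E)) ≡ free E
free-peel E h = begin
    step (weight a) (encode a t)
  ≡⟨ sym (weight-∖-decode a (encode a t)) ⟩
    suc (weight (a ∖ decode a (encode a t)))
  ≡⟨ cong (λ t′ → suc (weight (a ∖ t′))) (decode-encode a t (proj₂ (peel-contraction E h))) ⟩
    suc (weight (a ∖ t))
  ≡⟨ sym (free-build (inner E) t) ⟩
    free (build (inner E) t)
  ≡⟨ cong free (build-inner E (contraction-peelable E h)) ⟩
    free E
  ∎
  where
  open ≡-Reasoning
  a t : Vec Bool _
  a = freeBlack (inner E)
  t = toprow E

ContractionsG : ℕ → Graded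
ContractionsG N = graded (ContractionOn N) (λ c → free (proj₁ c))

peel : ∀ N → ContractionsG (suc (suc N)) ≅ extend (ContractionsG N)
peel N = record
  { iso       = mk↔ₛ′ split join split-join join-split
  ; preserves = λ (E , p) → free-peel E (holds E p)
  }
  where
  split : ContractionOn (suc (suc N)) → Carrier (extend (ContractionsG N))
  split (E , p) = (inner E , checks (inner E) (proj₁ (peel-contraction E (holds E p))))
                , encode (freeBlack (inner E)) (toprow E)

  join : Carrier (extend (ContractionsG N)) → ContractionOn (suc (suc N))
  join ((c , p) , r) = build c (decode (freeBlack c) r)
    , checks (build c (decode (freeBlack c) r)) (build-contraction c _ (holds c p , decode-selection (freeBlack c) r))

  join-split : ∀ E → join (split E) ≡ E
  join-split (E , p) = contraction-≡
    (trans (cong (build (inner E)) (decode-encode _ _ (proj₂ (peel-contraction E (holds E p)))))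
           (build-inner E (contraction-peelable E (holds E p))))

  split-join : ∀ c → split (join c) ≡ c
  split-join ((c , p) , r) = reassemble (inner-build c (decode (freeBlack c) r)) _
    where
    reassemble : ∀ {c′} (e : c′ ≡ c) (p′ : isContractionᵇ c′ ≡ true) →
                 _≡_ {A = Carrier (extend (ContractionsG N))}
                     ((c′ , p′) , encode (freeBlack c′) (decode (freeBlack c) r)) ((c , p) , r)
    reassemble refl p′ = trans (cong (λ q → (c , q) , _) (bool-≡-irrelevant p′ p))
                               (cong ((c , p) ,_) (encode-decode (freeBlack c) r))

contractions-cast : ∀ {N M} → N ≡ M → ContractionsG N ≅ ContractionsG M
contractions-cast refl = record { iso = ↔-refl ; preserves = λ _ → refl }

empty-contraction : ContractionsG 0 ≅ ChoicesG 0 0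
empty-contraction = record
  { iso       = mk↔ₛ′ (λ _ → tt) (λ _ → [] , refl) (λ _ → refl) (λ { ([] , p) → contraction-≡ refl })
  ; preserves = λ { ([] , p) → refl }
  }

tower : ∀ m → ContractionsG (2 * m) ≅ ChoicesG 0 m
tower zero    = empty-contraction
tower (suc m) =
  ≅-trans (contractions-cast (*-suc 2 m))     -- 2 (m+1) vertices are 2 + 2m vertices
  (≅-trans (peel (2 * m))
  (≅-trans (extend-cong (tower m))
           (choices-snoc 0 m)))

-- The theorem; the bijection exists for every n.

mainTheorem1 : (n : ℕ) → 1 ≤ n → Contraction (suc n) ⤖ GeneratedMultiset n
mainTheorem1 n _ = ↔⇒⤖ (begin
  Contraction (suc n)  ↔⟨ iso (tower (suc n)) ⟩
  Choices 0 (suc n)    ↔⟨ first-choice-forced n ⟩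
  Choices 1 n          ↔⟨ runs↔choices 1 n ⟨
  Runs 1 n             ↔⟨ admissible↔runs n ⟨
  Admissible n         ↔⟨ multiset↔admissible n ⟨
  GeneratedMultiset n  ∎)
  where open EquationalReasoning {k = bijection}
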